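{- Let $(P_3,\sigma)$ be a signed path $xzy$ with $\sigma(xz)=\alpha$ and $\sigma(zy)=\beta$. Let $X$ be a layered $6$-set. Then for every $c_x\in X$ and every $c_y\in X^{\alpha\beta}$ there exists $c_z\in C$ such that $c_zc_x$ and $c_zc_y$ are edges of ${\rm DSG}(K_6,M)$ with $m^*(c_zc_x)=\sigma(zx)$ and $m^*(c_zc_y)=\sigma(zy)$.
   Context: Let $C=\{i^+,i^-:1\le i\le 6\}$ be the vertex set of ${\rm DSG}(K_6,M)$ with signature $m^*$: for $i\ne j$ and $\gamma\in\{+,-\}$, $i^\gamma j^\gamma$ is an edge, negative if $\{i,j\}\in\{\{1,2\},\{3,4\},\{5,6\}\}$ and positive otherwise; $i^\gamma j^{ -\gamma}$ is an edge, positive if $\{i,j\}\in\{\{1,2\},\{3,4\},\{5,6\}\}$ and negative otherwise; $i^+,i^-$ are non-adjacent. The pair of $(2l-1)^\gamma$ is $(2l)^\gamma$ and vice versa; a layer is $\{(2l-1)^+,(2l)^+,(2l-1)^-,(2l)^-\}$, $l=1,2,3$. A set is paired if all but at most one of its elements have their pair in it; a paired set is layered if no three of its elements lie in a common layer; a layered $6$-set is a layered set of size $6$. The inverse of $i^\gamma$ is $i^{ -\gamma}$; for $X\subseteq C$, $X^-$ is the set of inverses of elements of $X$. $X^{\alpha\beta}$ denotes $X$ if $\alpha\beta=+$ (i.e., $\alpha=\beta$) and $X^-$ if $\alpha\beta=-$. -}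

module Defs where

open import Data.Nat using (ℕ; _≤_; _+_)
open import Data.Fin using (Fin; toℕ)
open import Data.Fin.Properties using (all?)
open import Data.Bool using (Bool; true; false; if_then_else_)
open import Data.Product using (_×_; _,_; proj₁; proj₂)
open import Data.List using (List; []; _∷_; allFin; filter; length; concatMap; map)
open import Relation.Nullary using (¬_; Dec; yes; no)
open import Relation.Nullary.Decidable using (⌊_⌋)
open import Relation.Binary.PropositionalEquality using (_≡_; _≢_)

data Sign : Set where
  pos neg : Sign

_·_ : Sign → Sign → Sign
pos · b = b
neg · pos = neg
neg · neg = pos

flip : Sign → Sign
flip pos = neg
flip neg = pos

-- Vertices of DSG(K_6,M): i^γ is (i , γ), with i ∈ Fin 6 standing for 1..6
-- (index 0 ↔ vertex 1, ..., index 5 ↔ vertex 6).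
Vertex : Set
Vertex = Fin 6 × Sign

layerOf : Fin 6 → ℕ
layerOf i = Data.Nat._/_ (toℕ i) 2
  where import Data.Nat

Adjacent : Vertex → Vertex → Set
Adjacent (i , _) (j , _) = i ≢ j

-- signature m* on an (adjacent) pair of vertices. For i ≠ j, {i,j} is one
-- of {1,2},{3,4},{5,6} iff i and j lie in the same layer.
sameSignB : Sign → Sign → Bool
sameSignB pos pos = true
sameSignB neg neg = true
sameSignB _ _ = false

m* : Vertex → Vertex → Sign
m* (i , γ) (j , δ) with sameSignB γ δ | ⌊ layerOf i Data.Nat.≟ layerOf j ⌋
  where import Data.Nat
... | true  | true  = neg
... | true  | false = pos
... | false | true  = pos
... | false | false = neg

pairIdx : Fin 6 → Fin 6
pairIdx Fin.zero = Fin.suc Fin.zero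
pairIdx (Fin.suc Fin.zero) = Fin.zero
pairIdx (Fin.suc (Fin.suc Fin.zero)) = Fin.suc (Fin.suc (Fin.suc Fin.zero))
pairIdx (Fin.suc (Fin.suc (Fin.suc Fin.zero))) = Fin.suc (Fin.suc Fin.zero)
pairIdx (Fin.suc (Fin.suc (Fin.suc (Fin.suc Fin.zero)))) = Fin.suc (Fin.suc (Fin.suc (Fin.suc (Fin.suc Fin.zero))))
pairIdx (Fin.suc (Fin.suc (Fin.suc (Fin.suc (Fin.suc Fin.zero))))) = Fin.suc (Fin.suc (Fin.suc (Fin.suc Fin.zero)))

pair : Vertex → Vertex
pair (i , γ) = (pairIdx i , γ)

inverse : Vertex → Vertex
inverse (i , γ) = (i , flip γ)

VSet : Set
VSet = Vertex → Bool

_∈_ : Vertex → VSet → Set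
v ∈ X = X v ≡ true

allVertices : List Vertex
allVertices = concatMap (λ i → (i , pos) ∷ (i , neg) ∷ []) (allFin 6)

countB : (Vertex → Bool) → ℕ
countB p = length (filter (λ v → Data.Bool._≟_ (p v) true) allVertices)
  where import Data.Bool

∣_∣ : VSet → ℕ
∣ X ∣ = countB X

Paired : VSet → Set
Paired X = countB (λ v → X v Data.Bool.∧ Data.Bool.not (X (pair v))) ≤ 1
  where import Data.Bool

inLayer : ℕ → Vertex → Bool
inLayer l (i , _) = ⌊ layerOf i Data.Nat.≟ l ⌋
  where import Data.Nat

Layered : VSet → Set
Layered X = Paired X × ((l : ℕ) → countB (λ v → X v Data.Bool.∧ inLayer l v) ≤ 2)
  where import Data.Bool

LayeredSixSet : VSet → Set
LayeredSixSet X = Layered X × ∣ X ∣ ≡ 6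

_⁻ : VSet → VSet
(X ⁻) v = X (inverse v)

_^_ : VSet → Sign → VSet
X ^ pos = X
X ^ neg = X ⁻

-- Write cx = i^γ and cy = j^δ. The sign of the edge k^s i^γ is s·γ·λ(k,i), where λ(k,i) is
-- negative exactly when k and i share a layer; so a middle vertex k^s exists as soon as some
-- k ∉ {i, j} has λ(k,i)·λ(k,j) = γ·δ·α·β, the sign s then being forced. With three layers such a k
-- exists (in a layer avoiding i and j, or the pair of i) unless i and j share a layer and
-- γ·δ ≠ α·β. That case cannot occur: X would then contain elements of opposite signs in the layer
-- of cx, which a layered set forbids, since together with a pair of either they would put three
-- elements into one layer, and otherwise both would be unpaired.
module Submission where

open import Defs
open import Data.Bool using (Bool; true; false; _∧_; not; if_then_else_) renaming (_≟_ to _≟ᵇ_)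
open import Data.Empty using (⊥; ⊥-elim)
open import Data.Fin using (Fin)
open import Data.Fin.Properties using (all?; any?)
open import Data.List using (List; []; _∷_; length)
open import Data.List.Membership.Propositional using () renaming (_∈_ to _∈ₗ_)
open import Data.List.Membership.Propositional.Properties using (∈-filter⁺; ∈-concatMap⁺; ∈-allFin)
open import Data.List.Properties using (length-removeAt′)
open import Data.List.Relation.Unary.All as All using (All; []; _∷_)
open import Data.List.Relation.Unary.AllPairs using ([]; _∷_)
open import Data.List.Relation.Unary.Any as Any using (here; there; _─_)
open import Data.List.Relation.Unary.Unique.Propositional using (Unique)
open import Data.Nat using (_≤_; _≟_; s≤s; z≤n)
open import Data.Nat.Properties using (≤-trans; ≤-reflexive; ≤⇒≯)
open import Data.Product using (Σ; ∃-syntax; _×_; _,_; proj₁; proj₂)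
open import Function using (_∘_)
open import Relation.Binary.Definitions using (DecidableEquality)
open import Relation.Binary.PropositionalEquality using (_≡_; _≢_; refl; sym; trans; cong; cong₂; module ≡-Reasoning)
open import Relation.Nullary using (yes; no; ¬?)
open import Relation.Nullary.Decidable using (⌊_⌋; toWitness; dec-true; dec-false; _×-dec_; decidable-stable; isYes≗does)

infix 4 _≟ₛ_
_≟ₛ_ : DecidableEquality Sign
pos ≟ₛ pos = yes refl
neg ≟ₛ neg = yes refl
pos ≟ₛ neg = no λ ()
neg ≟ₛ pos = no λ ()

·-identityʳ : ∀ a → a · pos ≡ a
·-identityʳ pos = refl
·-identityʳ neg = refl

·-cancelʳ : ∀ a b → (a · b) · b ≡ a
·-cancelʳ pos pos = refl
·-cancelʳ pos neg = refl
·-cancelʳ neg pos = refl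
·-cancelʳ neg neg = refl

neg·≡flip : ∀ a → neg · a ≡ flip a
neg·≡flip pos = refl
neg·≡flip neg = refl

·neg-·pos≡flip : ∀ a b → (a · neg) · (b · pos) ≡ flip (a · b)
·neg-·pos≡flip pos pos = refl
·neg-·pos≡flip pos neg = refl
·neg-·pos≡flip neg pos = refl
·neg-·pos≡flip neg neg = refl

≢⇒≡flip : ∀ {a b} → a ≢ b → a ≡ flip b
≢⇒≡flip {pos} {pos} a≢b = ⊥-elim (a≢b refl)
≢⇒≡flip {pos} {neg} _ = refl
≢⇒≡flip {neg} {pos} _ = refl
≢⇒≡flip {neg} {neg} a≢b = ⊥-elim (a≢b refl)

·-solve : ∀ {a b α β} → a · b ≡ α · β → (α · a) · a ≡ α × (α · a) · b ≡ β
·-solve {pos} {α = pos} b≡β = refl , b≡β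
·-solve {pos} {α = neg} refl = refl , trans (neg·≡flip _) (flipflip _)
  where
  flipflip : ∀ a → flip (neg · a) ≡ a
  flipflip pos = refl
  flipflip neg = refl
·-solve {neg} {α = pos} eq = refl , eq
·-solve {neg} {b} {α = neg} {β} eq = refl , cancel b β eq
  where
  cancel : ∀ b β → neg · b ≡ neg · β → b ≡ β
  cancel pos pos _ = refl
  cancel neg neg _ = refl

^-sign : ∀ X ω j δ → (X ^ ω) (j , δ) ≡ X (j , ω · δ)
^-sign X pos j δ = refl
^-sign X neg j δ = cong (λ s → X (j , s)) (sym (neg·≡flip δ))

⌊≟⌋-true : ∀ {m n} → m ≡ n → ⌊ m ≟ n ⌋ ≡ true
⌊≟⌋-true {m} {n} m≡n = trans (isYes≗does (m ≟ n)) (dec-true (m ≟ n) m≡n)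

⌊≟⌋-false : ∀ {m n} → m ≢ n → ⌊ m ≟ n ⌋ ≡ false
⌊≟⌋-false {m} {n} m≢n = trans (isYes≗does (m ≟ n)) (dec-false (m ≟ n) m≢n)

layerSign : Fin 6 → Fin 6 → Sign
layerSign k i = if ⌊ layerOf k ≟ layerOf i ⌋ then neg else pos

layerSign-same : ∀ k i → layerOf k ≡ layerOf i → layerSign k i ≡ neg
layerSign-same k i = cong (if_then neg else pos) ∘ ⌊≟⌋-true

layerSign-apart : ∀ k i → layerOf k ≢ layerOf i → layerSign k i ≡ pos
layerSign-apart k i = cong (if_then neg else pos) ∘ ⌊≟⌋-false

m*-formula : ∀ k s i γ → m* (k , s) (i , γ) ≡ s · (γ · layerSign k i)
m*-formula k s i γ with ⌊ layerOf k ≟ layerOf i ⌋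
m*-formula k pos i pos | true = refl
m*-formula k pos i neg | true = refl
m*-formula k neg i pos | true = refl
m*-formula k neg i neg | true = refl
m*-formula k pos i pos | false = refl
m*-formula k pos i neg | false = refl
m*-formula k neg i pos | false = refl
m*-formula k neg i neg | false = refl

pairIdx-irreflexive : ∀ i → pairIdx i ≢ i
pairIdx-irreflexive Fin.zero = λ ()
pairIdx-irreflexive (Fin.suc Fin.zero) = λ ()
pairIdx-irreflexive (Fin.suc (Fin.suc Fin.zero)) = λ ()
pairIdx-irreflexive (Fin.suc (Fin.suc (Fin.suc Fin.zero))) = λ ()
pairIdx-irreflexive (Fin.suc (Fin.suc (Fin.suc (Fin.suc Fin.zero)))) = λ ()
pairIdx-irreflexive (Fin.suc (Fin.suc (Fin.suc (Fin.suc (Fin.suc Fin.zero))))) = λ ()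

layerOf-pairIdx : ∀ i → layerOf (pairIdx i) ≡ layerOf i
layerOf-pairIdx Fin.zero = refl
layerOf-pairIdx (Fin.suc Fin.zero) = refl
layerOf-pairIdx (Fin.suc (Fin.suc Fin.zero)) = refl
layerOf-pairIdx (Fin.suc (Fin.suc (Fin.suc Fin.zero))) = refl
layerOf-pairIdx (Fin.suc (Fin.suc (Fin.suc (Fin.suc Fin.zero)))) = refl
layerOf-pairIdx (Fin.suc (Fin.suc (Fin.suc (Fin.suc (Fin.suc Fin.zero))))) = refl

outsideLayers : ∀ i j → ∃[ k ] (layerOf k ≢ layerOf i × layerOf k ≢ layerOf j)
outsideLayers = toWitness {a? = all? λ i → all? λ j → any? λ k →
  ¬? (layerOf k ≟ layerOf i) ×-dec ¬? (layerOf k ≟ layerOf j)} _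

middleIndex : ∀ i j γ δ ω → (layerOf i ≡ layerOf j → γ · δ ≡ ω) →
  ∃[ k ] (k ≢ i × k ≢ j × (γ · layerSign k i) · (δ · layerSign k j) ≡ ω)
middleIndex i j γ δ ω sameLayer⇒ with ω ≟ₛ γ · δ | layerOf i ≟ layerOf j
... | yes refl | _ = outside (outsideLayers i j)
  where
  outside : ∃[ k ] (layerOf k ≢ layerOf i × layerOf k ≢ layerOf j) →
    ∃[ k ] (k ≢ i × k ≢ j × (γ · layerSign k i) · (δ · layerSign k j) ≡ γ · δ)
  outside (k , k∉Lᵢ , k∉Lⱼ) =
    k , k∉Lᵢ ∘ cong layerOf , k∉Lⱼ ∘ cong layerOf ,
    trans (cong₂ (λ a b → (γ · a) · (δ · b)) (layerSign-apart k i k∉Lᵢ) (layerSign-apart k j k∉Lⱼ))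
          (cong₂ _·_ (·-identityʳ γ) (·-identityʳ δ))
... | no ω≢γδ | no Lᵢ≢Lⱼ =
  pairIdx i , pairIdx-irreflexive i , Lᵢ≢Lⱼ ∘ L[i']≡_ ∘ cong layerOf ,
  trans (cong₂ (λ a b → (γ · a) · (δ · b))
               (layerSign-same (pairIdx i) i (layerOf-pairIdx i))
               (layerSign-apart (pairIdx i) j (Lᵢ≢Lⱼ ∘ L[i']≡_)))
        (trans (·neg-·pos≡flip γ δ) (sym (≢⇒≡flip ω≢γδ)))
  where
  L[i']≡_ : ∀ {l} → layerOf (pairIdx i) ≡ l → layerOf i ≡ l
  L[i']≡_ = trans (sym (layerOf-pairIdx i))
... | no ω≢γδ | yes Lᵢ≡Lⱼ = ⊥-elim (ω≢γδ (sym (sameLayer⇒ Lᵢ≡Lⱼ)))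

module _ {A : Set} where

  ∈-─⁺ : ∀ {x y} {xs : List A} (x∈xs : x ∈ₗ xs) → y ∈ₗ xs → y ≢ x → y ∈ₗ (xs ─ x∈xs)
  ∈-─⁺ (here refl) (here refl) y≢x = ⊥-elim (y≢x refl)
  ∈-─⁺ (here refl) (there y∈xs) _ = y∈xs
  ∈-─⁺ (there x∈xs) (here refl) _ = here refl
  ∈-─⁺ (there x∈xs) (there y∈xs) y≢x = there (∈-─⁺ x∈xs y∈xs y≢x)

  Unique⊆⇒length≤ : ∀ {ys xs : List A} → Unique ys → All (_∈ₗ xs) ys → length ys ≤ length xs
  Unique⊆⇒length≤ [] [] = z≤n
  Unique⊆⇒length≤ {xs = xs} (y≢ys ∷ unique) (y∈xs ∷ ys⊆xs) =
    ≤-trans (s≤s (Unique⊆⇒length≤ unique ys⊆xs─y))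
            (≤-reflexive (sym (length-removeAt′ xs (Any.index y∈xs))))
    where
    ys⊆xs─y = All.zipWith (λ (z∈xs , y≢z) → ∈-─⁺ y∈xs z∈xs (y≢z ∘ sym)) (ys⊆xs , y≢ys)

∈-allVertices : ∀ v → v ∈ₗ allVertices
∈-allVertices (i , s) =
  ∈-concatMap⁺ (λ k → (k , pos) ∷ (k , neg) ∷ []) (Any.map (λ { refl → signs s }) (∈-allFin i))
  where
  signs : ∀ s → (i , s) ∈ₗ ((i , pos) ∷ (i , neg) ∷ [])
  signs pos = here refl
  signs neg = there (here refl)

Unique⇒length≤countB : ∀ {vs} (p : Vertex → Bool) → Unique vs → All (λ v → p v ≡ true) vs →
  length vs ≤ countB p
Unique⇒length≤countB p unique holds = Unique⊆⇒length≤ unique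
  (All.map (λ {v} → ∈-filter⁺ (λ v → p v ≟ᵇ true) (∈-allVertices v)) holds)

∧-intro : ∀ {a b} → a ≡ true → b ≡ true → a ∧ b ≡ true
∧-intro refl refl = refl

Layered⇒signConstantOnLayers : ∀ {X i j γ δ} → Layered X → (i , γ) ∈ X → (j , δ) ∈ X →
  layerOf i ≡ layerOf j → γ ≡ δ
Layered⇒signConstantOnLayers {X} {i} {j} {γ} {δ} (paired , thin) u∈X v∈X Lᵢ≡Lⱼ =
  decidable-stable (γ ≟ₛ δ) λ γ≢δ → byPairs γ≢δ (X (pair u)) refl (X (pair v)) refl
  where
  u v : Vertex
  u = i , γ
  v = j , δ

  inLayerᵢ : ∀ w → layerOf (proj₁ w) ≡ layerOf i → inLayer (layerOf i) w ≡ true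
  inLayerᵢ (k , _) = ⌊≟⌋-true

  pair-irreflexive : ∀ w → pair w ≢ w
  pair-irreflexive (k , _) = pairIdx-irreflexive k ∘ cong proj₁

  module _ (γ≢δ : γ ≢ δ) where

    apart : ∀ {k l} → (k , γ) ≢ (l , δ)
    apart = γ≢δ ∘ cong proj₂

    crowded : ∀ w → w ∈ X → layerOf (proj₁ w) ≡ layerOf i → u ≢ w → v ≢ w → ⊥
    crowded w w∈X w∈Lᵢ u≢w v≢w = ≤⇒≯ (thin (layerOf i))
      (Unique⇒length≤countB (λ w → X w ∧ inLayer (layerOf i) w)
        ((apart ∷ u≢w ∷ []) ∷ (v≢w ∷ []) ∷ [] ∷ [])
        (∧-intro u∈X (inLayerᵢ u refl) ∷ ∧-intro v∈X (inLayerᵢ v (sym Lᵢ≡Lⱼ)) ∷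
         ∧-intro w∈X (inLayerᵢ w w∈Lᵢ) ∷ []))

    byPairs : ∀ a → X (pair u) ≡ a → ∀ b → X (pair v) ≡ b → ⊥
    byPairs true pu∈X _ _ =
      crowded (pair u) pu∈X (layerOf-pairIdx i) (pair-irreflexive u ∘ sym) (apart ∘ sym)
    byPairs false _ true pv∈X =
      crowded (pair v) pv∈X (trans (layerOf-pairIdx j) (sym Lᵢ≡Lⱼ)) apart (pair-irreflexive v ∘ sym)
    byPairs false pu∉X false pv∉X = ≤⇒≯ paired
      (Unique⇒length≤countB (λ w → X w ∧ not (X (pair w)))
        ((apart ∷ []) ∷ [] ∷ [])
        (∧-intro u∈X (cong not pu∉X) ∷ ∧-intro v∈X (cong not pv∉X) ∷ []))

middleVertex : ∀ α β i γ j δ → (layerOf i ≡ layerOf j → γ · δ ≡ α · β) →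
  Σ Vertex (λ cz → (Adjacent cz (i , γ) × m* cz (i , γ) ≡ α) × (Adjacent cz (j , δ) × m* cz (j , δ) ≡ β))
middleVertex α β i γ j δ sameLayer⇒
  with k , k≢i , k≢j , product ← middleIndex i j γ δ (α · β) sameLayer⇒ =
  (k , s) , (k≢i , trans (m*-formula k s i γ) s-fits-i) , (k≢j , trans (m*-formula k s j δ) s-fits-j)
  where
  s = α · (γ · layerSign k i)
  s-fits-i = proj₁ (·-solve product)
  s-fits-j = proj₂ (·-solve product)

lemma4p7 : (α β : Sign) (X : VSet) → LayeredSixSet X →
    (cx cy : Vertex) → cx ∈ X → cy ∈ (X ^ (α · β)) →
    Σ Vertex (λ cz → (Adjacent cz cx × m* cz cx ≡ α) × (Adjacent cz cy × m* cz cy ≡ β))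
lemma4p7 α β X (layered , _) (i , γ) (j , δ) cx∈X cy∈X^αβ = middleVertex α β i γ j δ sameLayer⇒
  where
  αβδ∈X : (j , (α · β) · δ) ∈ X
  αβδ∈X = trans (sym (^-sign X (α · β) j δ)) cy∈X^αβ

  sameLayer⇒ : layerOf i ≡ layerOf j → γ · δ ≡ α · β
  sameLayer⇒ Lᵢ≡Lⱼ = begin
    γ · δ               ≡⟨ cong (_· δ) (Layered⇒signConstantOnLayers {X} layered cx∈X αβδ∈X Lᵢ≡Lⱼ) ⟩
    ((α · β) · δ) · δ   ≡⟨ ·-cancelʳ (α · β) δ ⟩
    α · β               ∎
    where open ≡-Reasoning
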